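{- Let $k\ge 1$ and let $x$ be an integer with $1\le x\le 2k$. Then $x\in P_{2k+1,2k+3}$. Moreover, if $x$ is odd then $\psi(x)=l_{(x+1)/2}=(k+\tfrac{x+1}{2},\,k-\tfrac{x+1}{2})$, and if $x$ is even then $\psi(x)=r_{x/2}=(\tfrac{x}{2}-1,\,2k-\tfrac{x}{2})$.
   Context: $\mathbb{N}$ denotes the non-negative integers. For coprime positive integers $s,t$, let $F_{s,t}=st-s-t$, $P_{s,t}=\mathbb{N}\setminus\{as+bt: a,b\in\mathbb{N}\}$ and $P'_{s,t}=\{(a,b)\in\mathbb{N}^2\mid as+bt\le F_{s,t}\}$. Every $x\in P_{s,t}$ can be written uniquely as $x=F_{s,t}-as-bt$ with $a,b\in\mathbb{N}$, and $\psi:P_{s,t}\to P'_{s,t}$ is defined by $\psi(F_{s,t}-as-bt)=(a,b)$. For $1\le i\le k$, $l_i=(k+i,k-i)$ and $r_i=(i-1,2k-i)$. -}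

module Defs where

open import Data.Nat using (ℕ; _+_; _*_; _∸_)
open import Data.Product using (_×_; _,_; ∃₂)
open import Relation.Nullary using (¬_)
open import Relation.Binary.PropositionalEquality using (_≡_)

-- Frobenius number F_{s,t} = st - s - t (only used for coprime s,t ≥ 2, where no truncation occurs)
F : ℕ → ℕ → ℕ
F s t = s * t ∸ s ∸ t

Representable : ℕ → ℕ → ℕ → Set
Representable s t x = ∃₂ λ a b → x ≡ a * s + b * t

_∈P[_,_] : ℕ → ℕ → ℕ → Set
x ∈P[ s , t ] = ¬ Representable s t x

-- graph of ψ : P_{s,t} → P'_{s,t}:  ψ(x) = (a,b)  iff  x ∈ P_{s,t} and x = F_{s,t} - a s - b t
-- (stated without truncated subtraction as x + a s + b t = F_{s,t}; such (a,b) is unique)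
ψ[_,_]_≡_ : ℕ → ℕ → ℕ → ℕ × ℕ → Set
ψ[ s , t ] x ≡ (a , b) = (x ∈P[ s , t ]) × (x + a * s + b * t ≡ F s t)

-- l_i = (k+i, k-i),  r_i = (i-1, 2k-i)   (for 1 ≤ i ≤ k, no truncation occurs)
l : ℕ → ℕ → ℕ × ℕ
l k i = (k + i , k ∸ i)

r : ℕ → ℕ → ℕ × ℕ
r k i = (i ∸ 1 , 2 * k ∸ i)

-- The generators s = 2k+1 and t = 2k+3 both exceed 2k, so no positive number up to 2k is a
-- combination of them.  The values of ψ are then certificates: for x = 2i-1 with (a,b) = l_i,
-- and for x = 2i with (a,b) = r_i, the sum x + a s + b t + s + t equals s t identically in i and k.
module Submission where

open import Defs
open import Data.Nat using (ℕ; zero; suc; _+_; _*_; _∸_; _≤_; _<_; _%_; _/_; s≤s; z≤n; NonZero)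
open import Data.Nat.Properties
open import Data.Nat.DivMod using (m≡m%n+[m/n]*n; m*n/n≡m)
open import Data.Nat.Tactic.RingSolver using (solve-∀)
open import Data.Product using (_×_; _,_)
open import Relation.Binary.PropositionalEquality

representable⇒≤ : ∀ {s t x} → s ≤ t → 1 ≤ x → Representable s t x → s ≤ x
representable⇒≤ s≤t () (zero , zero , refl)
representable⇒≤ {s} s≤t _ (suc a , b , refl) = ≤-trans (m≤m+n s (a * s)) (m≤m+n _ (b * _))
representable⇒≤ {t = t} s≤t _ (zero , suc b , refl) = ≤-trans s≤t (m≤m+n t (b * t))

<min⇒∈P : ∀ {s t x} → s ≤ t → 1 ≤ x → x < s → x ∈P[ s , t ]
<min⇒∈P s≤t 1≤x x<s rep = <⇒≱ x<s (representable⇒≤ s≤t 1≤x rep)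

y+[s+t]≡s*t⇒y≡F : ∀ s t {y} → y + (s + t) ≡ s * t → y ≡ F s t
y+[s+t]≡s*t⇒y≡F s t {y} eq = begin
  y                     ≡⟨ m+n∸n≡m y (s + t) ⟨
  y + (s + t) ∸ (s + t) ≡⟨ cong (_∸ (s + t)) eq ⟩
  s * t ∸ (s + t)       ≡⟨ ∸-+-assoc (s * t) s t ⟨
  F s t                 ∎
  where open ≡-Reasoning

%-decomposition : ∀ {x n ρ} .{{_ : NonZero n}} → x % n ≡ ρ → x ≡ ρ + x / n * n
%-decomposition {x} {n} h = trans (m≡m%n+[m/n]*n x n) (cong (_+ x / n * n) h)

≤2*⇒∈P : ∀ k {x} → 1 ≤ x → x ≤ 2 * k → x ∈P[ 2 * k + 1 , 2 * k + 3 ]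
≤2*⇒∈P k {x} 1≤x x≤2k =
  <min⇒∈P (+-monoʳ-≤ (2 * k) (s≤s z≤n)) 1≤x (subst (x <_) (+-comm 1 (2 * k)) (s≤s x≤2k))

1+m*2≤2*k⇒m<k : ∀ {k m} → 1 + m * 2 ≤ 2 * k → m < k
1+m*2≤2*k⇒m<k {k} {m} le = *-cancelʳ-< 2 m k (subst (1 + m * 2 ≤_) (*-comm 2 k) le)

ψ-odd : ∀ k m → 1 + m * 2 ≤ 2 * k → ψ[ 2 * k + 1 , 2 * k + 3 ] (1 + m * 2) ≡ l k (suc m)
ψ-odd k m x≤2k with m≤n⇒∃[o]m+o≡n (1+m*2≤2*k⇒m<k {k} {m} x≤2k)
... | j , refl rewrite m+n∸m≡n (suc m) j =
  ≤2*⇒∈P k (s≤s z≤n) x≤2k , y+[s+t]≡s*t⇒y≡F (2 * k + 1) (2 * k + 3) (identity m j)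
  where
  identity : ∀ m j → let k = suc m + j in
    1 + m * 2 + (k + suc m) * (2 * k + 1) + j * (2 * k + 3) + ((2 * k + 1) + (2 * k + 3))
      ≡ (2 * k + 1) * (2 * k + 3)
  identity = solve-∀

2*[i+j]∸i≡i+2*j : ∀ i j → 2 * (i + j) ∸ i ≡ i + 2 * j
2*[i+j]∸i≡i+2*j i j = trans (cong (_∸ i) (split i j)) (m+n∸m≡n i (i + 2 * j))
  where
  split : ∀ i j → 2 * (i + j) ≡ i + (i + 2 * j)
  split = solve-∀

ψ-even : ∀ k m → suc m * 2 ≤ 2 * k → ψ[ 2 * k + 1 , 2 * k + 3 ] (suc m * 2) ≡ r k (suc m)
ψ-even k m x≤2k with m≤n⇒∃[o]m+o≡n (1+m*2≤2*k⇒m<k {k} {m} (<⇒≤ x≤2k))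
... | j , refl rewrite 2*[i+j]∸i≡i+2*j (suc m) j =
  ≤2*⇒∈P k (s≤s z≤n) x≤2k , y+[s+t]≡s*t⇒y≡F (2 * k + 1) (2 * k + 3) (identity m j)
  where
  identity : ∀ m j → let k = suc m + j in
    suc m * 2 + m * (2 * k + 1) + (suc m + 2 * j) * (2 * k + 3) + ((2 * k + 1) + (2 * k + 3))
      ≡ (2 * k + 1) * (2 * k + 3)
  identity = solve-∀

lemma3p6 : (k x : ℕ) → 1 ≤ k → 1 ≤ x → x ≤ 2 * k →
    (x ∈P[ 2 * k + 1 , 2 * k + 3 ])
    × (x % 2 ≡ 1 → ψ[ 2 * k + 1 , 2 * k + 3 ] x ≡ l k ((x + 1) / 2))
    × (x % 2 ≡ 0 → ψ[ 2 * k + 1 , 2 * k + 3 ] x ≡ r k (x / 2))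
lemma3p6 k x _ 1≤x x≤2k = ≤2*⇒∈P k 1≤x x≤2k , odd , even
  where
  odd : x % 2 ≡ 1 → ψ[ 2 * k + 1 , 2 * k + 3 ] x ≡ l k ((x + 1) / 2)
  odd x%2≡1 = subst₂ (λ y i → ψ[ 2 * k + 1 , 2 * k + 3 ] y ≡ l k i) (sym x≡) (sym half)
                (ψ-odd k (x / 2) (subst (_≤ 2 * k) x≡ x≤2k))
    where
    x≡ : x ≡ 1 + x / 2 * 2
    x≡ = %-decomposition x%2≡1
    half : (x + 1) / 2 ≡ suc (x / 2)
    half = trans (cong (_/ 2) (trans (cong (_+ 1) x≡) (+-comm (1 + x / 2 * 2) 1)))
                 (m*n/n≡m (suc (x / 2)) 2)
  even : x % 2 ≡ 0 → ψ[ 2 * k + 1 , 2 * k + 3 ] x ≡ r k (x / 2)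
  even x%2≡0 = subst (λ y → ψ[ 2 * k + 1 , 2 * k + 3 ] y ≡ r k (x / 2)) (sym x≡)
                 (positive (x / 2) (subst (1 ≤_) x≡ 1≤x) (subst (_≤ 2 * k) x≡ x≤2k))
    where
    x≡ : x ≡ x / 2 * 2
    x≡ = %-decomposition x%2≡0
    positive : ∀ i → 1 ≤ i * 2 → i * 2 ≤ 2 * k → ψ[ 2 * k + 1 , 2 * k + 3 ] (i * 2) ≡ r k i
    positive zero    ()
    positive (suc m) _ = ψ-even k m
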